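{- The length of any Stabbing Planes refutation of $\mathrm{SPHP}_n$ is $\Omega(n^{1/4})$. Hence the minimal depth of a Stabbing Planes refutation of $\mathrm{SPHP}_n$ is $\Omega(\log n)$.
   Context: $\mathrm{SPHP}_n$ (Simplified Pigeonhole Principle) is the set of integer linear inequalities over $x_1,\dots,x_n$: $\sum_{i=1}^n x_i\geq 2$, and $x_i+x_j\leq 1$ for all $i\neq j\in[n]$. A Stabbing Planes (SP) refutation of an unsatisfiable set $\mathcal{F}$ of integer linear inequalities in variables $x_1,\dots,x_N$ is a binary tree in which each internal node is labelled by a query $(\mathbf a,b)$ with $\mathbf a\in\mathbb Z^N$, $b\in\mathbb Z$, its two outgoing edges being labelled $\mathbf a\mathbf x\geq b$ and $\mathbf a\mathbf x\leq b-1$, such that for every leaf the linear program consisting of $\mathcal{F}$ together with the inequalities on the edges of the root-to-leaf path is infeasible over $\mathbb R$. Its length is the number of queries; its depth is the length of the longest root-to-leaf path. -}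

module Defs where

open import Data.Nat as ℕ using (ℕ; zero; suc; _⊔_)
open import Data.Fin using (Fin; zero; suc)
open import Data.Integer as ℤ using (ℤ)
open import Data.Rational as ℚ using (ℚ)
open import Data.List using (List; []; _∷_)
open import Data.List.Relation.Unary.All using (All)
open import Data.Product using (Σ; _×_)
open import Relation.Nullary using (¬_)
open import Relation.Binary.PropositionalEquality using (_≢_)

Coeffs : ℕ → Set
Coeffs N = Fin N → ℤ

data Ineq (N : ℕ) : Set where
  _≥ᵢ_ : Coeffs N → ℤ → Ineq N
  _≤ᵢ_ : Coeffs N → ℤ → Ineq N

Formula : ℕ → Set₁
Formula N = Ineq N → Set

sumℚ : ∀ {N} → (Fin N → ℚ) → ℚ
sumℚ {zero} f = ℚ.0ℚ
sumℚ {suc N} f = f zero ℚ.+ sumℚ (λ i → f (suc i))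

toℚ : ℤ → ℚ
toℚ z = z ℚ./ 1

dot : ∀ {N} → Coeffs N → (Fin N → ℚ) → ℚ
dot a x = sumℚ (λ i → toℚ (a i) ℚ.* x i)

Sat : ∀ {N} → (Fin N → ℚ) → Ineq N → Set
Sat x (a ≥ᵢ b) = toℚ b ℚ.≤ dot a x
Sat x (a ≤ᵢ b) = dot a x ℚ.≤ toℚ b

Feasible : ∀ {N} → Formula N → List (Ineq N) → Set
Feasible {N} F P =
  Σ (Fin N → ℚ) λ x → ((I : Ineq N) → F I → Sat x I) × All (Sat x) P

-- Stabbing Planes trees: internal nodes are queries (a , b);
-- left child: a·x ≥ b, right child: a·x ≤ b - 1
data SPTree (N : ℕ) : Set where
  leaf  : SPTree N
  query : Coeffs N → ℤ → SPTree N → SPTree N → SPTree N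

IsRefutationFrom : ∀ {N} → Formula N → List (Ineq N) → SPTree N → Set
IsRefutationFrom F P leaf = ¬ Feasible F P
IsRefutationFrom F P (query a b l r) =
  IsRefutationFrom F ((a ≥ᵢ b) ∷ P) l ×
  IsRefutationFrom F ((a ≤ᵢ (b ℤ.- ℤ.1ℤ)) ∷ P) r

IsSPRefutation : ∀ {N} → Formula N → SPTree N → Set
IsSPRefutation F T = IsRefutationFrom F [] T

spLength : ∀ {N} → SPTree N → ℕ
spLength leaf = 0
spLength (query _ _ l r) = suc (spLength l ℕ.+ spLength r)

spDepth : ∀ {N} → SPTree N → ℕ
spDepth leaf = 0
spDepth (query _ _ l r) = suc (spDepth l ⊔ spDepth r)

e : ∀ {N} → Fin N → Coeffs N
e {suc N} zero zero = ℤ.1ℤ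
e {suc N} zero (suc j) = ℤ.0ℤ
e {suc N} (suc i) zero = ℤ.0ℤ
e {suc N} (suc i) (suc j) = e i j

data SPHP (n : ℕ) : Formula n where
  sumAxiom  : SPHP n ((λ _ → ℤ.1ℤ) ≥ᵢ (ℤ.+ 2))
  pairAxiom : (i j : Fin n) → i ≢ j → SPHP n ((λ k → e i k ℤ.+ e j k) ≤ᵢ ℤ.1ℤ)

-- If a tree has L queries and n ≥ L + 4, the parity vectors of the L query
-- coefficient vectors are L homogeneous linear equations over GF(2) in n unknowns,
-- so Gaussian elimination yields a set S, |S| ≥ 4, on which every query vector has
-- even sum. The point x = ½·1_S satisfies SPHP_n (Σ x = |S|/2 ≥ 2, x_i + x_j ≤ 1)
-- and makes every a·x an integer, so it never lies in an open slab b - 1 < a·x < b: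
-- it follows a branch of the tree to a leaf whose LP it satisfies. Hence n ≤ L + 3,
-- which is stronger than L = Ω(n^{1/4}); the depth bound follows from L < 2^depth.
module Submission where

open import Defs
open import Algebra.Bundles using (CommutativeRing)
open import Data.Bool using (Bool; true; false; _∧_; _xor_; if_then_else_)
open import Data.Bool.Properties
  using (xor-same; xor-comm; ∧-distribʳ-xor; ∧-identityʳ; ∧-zeroʳ; xor-∧-commutativeRing)
open import Algebra.Properties.CommutativeSemigroup
  (CommutativeRing.+-commutativeSemigroup xor-∧-commutativeRing) renaming (interchange to xor-interchange)
open import Data.Fin using (Fin; zero; suc)
open import Data.Integer as ℤ using (ℤ; +_; 0ℤ; 1ℤ)
open import Data.Integer.Properties as ℤ using ()
open import Algebra.Properties.CommutativeSemigroup ℤ.+-commutativeSemigroup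
  renaming (interchange to +-interchange)
open import Data.Integer.Tactic.RingSolver using (solve-∀)
open import Data.List using (List; []; _∷_; _++_; length; map)
open import Data.List.Properties using (length-map; length-++)
open import Data.List.Relation.Unary.All as All using (All; []; _∷_)
open import Data.List.Relation.Unary.All.Properties using (map⁻; ++⁻ˡ; ++⁻ʳ)
open import Data.List.Relation.Binary.Permutation.Propositional
  using (_↭_; ↭-refl; ↭-sym; ↭-trans; prep; swap)
open import Data.List.Relation.Binary.Permutation.Propositional.Properties using (All-resp-↭; ↭-length)
open import Data.Nat as ℕ using (ℕ; zero; suc; _+_; _*_; _^_; _⊔_; _≤_; _<_; z≤n; s≤s)
open import Data.Nat.Logarithm using (⌊log₂_⌋; ⌊log₂⌋-mono-≤; ⌊log₂[2^n]⌋≡n)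
open import Data.Nat.Properties as ℕ
  using ( ≤-trans; ≤-pred; +-suc; +-comm; +-identityʳ; m+n≤o⇒n≤o; +-mono-≤; +-monoʳ-≤
        ; *-monoʳ-≤; m≤m*n; ^-monoʳ-≤; m^n≢0; m≤m⊔n; m≤n⊔m)
open import Data.Product using (Σ; _×_; _,_; ∃-syntax; proj₁; proj₂)
open import Data.Rational as ℚ using (ℚ; ½; 0ℚ)
open import Data.Rational.Properties as ℚ using ()
open import Data.Rational.Unnormalised as ℚᵘ using (mkℚᵘ; *≡*; *≤*)
open import Data.Rational.Unnormalised.Properties as ℚᵘ using ()
open import Data.Sum using (_⊎_; inj₁; inj₂)
open import Data.Vec.Functional using (Vector; head; tail; foldr; zipWith; replicate)
  renaming (_∷_ to _◂_)
open import Function using (_∘_)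
open import Relation.Binary.PropositionalEquality
open import Relation.Nullary using (¬_; contradiction; yes; no)

private variable n : ℕ

-- Homogeneous linear systems over GF(2)

infixl 6 _⊕_
infix 7 _·_

_⊕_ : Vector Bool n → Vector Bool n → Vector Bool n
_⊕_ = zipWith _xor_

_·_ : Vector Bool n → Vector Bool n → Bool
c · s = foldr _xor_ false (zipWith _∧_ c s)

weight : Vector Bool n → ℕ
weight = foldr (λ b w → if b then suc w else w) 0

·-zeroʳ : (c : Vector Bool n) → c · replicate n false ≡ false
·-zeroʳ {zero} c = refl
·-zeroʳ {suc n} c with c zero
... | true = ·-zeroʳ (tail c)
... | false = ·-zeroʳ (tail c)

·-distribʳ-⊕ : (f g y : Vector Bool n) → (f ⊕ g) · y ≡ f · y xor g · y
·-distribʳ-⊕ {zero} f g y = refl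
·-distribʳ-⊕ {suc n} f g y = begin
  (f zero xor g zero) ∧ y zero xor (tail f ⊕ tail g) · tail y
    ≡⟨ cong₂ _xor_ (∧-distribʳ-xor (y zero) (f zero) (g zero)) (·-distribʳ-⊕ (tail f) (tail g) (tail y)) ⟩
  (f zero ∧ y zero xor g zero ∧ y zero) xor (tail f · tail y xor tail g · tail y)
    ≡⟨ xor-interchange (f zero ∧ y zero) (g zero ∧ y zero) (tail f · tail y) (tail g · tail y) ⟩
  (f zero ∧ y zero xor tail f · tail y) xor (g zero ∧ y zero xor tail g · tail y) ∎
  where open ≡-Reasoning

weight-tail : (s : Vector Bool (suc n)) → weight (tail s) ≤ weight s
weight-tail s with s zero
... | true = ℕ.n≤1+n _
... | false = ℕ.≤-refl

data PivotView {n} (cs : List (Vector Bool (suc n))) : Set where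
  no-pivot : All (λ c → head c ≡ false) cs → PivotView cs
  pivot    : ∀ p rest → head p ≡ true → cs ↭ p ∷ rest → PivotView cs

pivotView : (cs : List (Vector Bool (suc n))) → PivotView cs
pivotView [] = no-pivot []
pivotView (c ∷ cs) with c zero in c₀
... | true = pivot c cs c₀ ↭-refl
... | false with pivotView cs
...   | no-pivot h = no-pivot (c₀ ∷ h)
...   | pivot p rest p₀ cs↭ = pivot p (c ∷ rest) p₀ (↭-trans (prep c cs↭) (swap c p ↭-refl))

eliminate : (p c : Vector Bool (suc n)) → Vector Bool n
eliminate p c = if head c then tail c ⊕ tail p else tail c

-- Setting the pivot coordinate to tail p · y makes p orthogonal, and then every
-- other row is orthogonal as soon as its reduced row is.
eliminate-sound : (p c : Vector Bool (suc n)) (y : Vector Bool n) →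
                  eliminate p c · y ≡ false → c · (tail p · y ◂ y) ≡ false
eliminate-sound p c y c'·y≡0 with c zero
... | true  = trans (xor-comm (tail p · y) (tail c · y))
                    (trans (sym (·-distribʳ-⊕ (tail c) (tail p) y)) c'·y≡0)
... | false = c'·y≡0

∃-orthogonal-of-weight≥ : ∀ n k (cs : List (Vector Bool n)) → length cs + k ≤ n →
  ∃[ s ] k ≤ weight s × All (λ c → c · s ≡ false) cs
∃-orthogonal-of-weight≥ n zero cs _ = replicate n false , z≤n , All.tabulate (λ {c} _ → ·-zeroʳ c)
∃-orthogonal-of-weight≥ zero (suc k) cs |cs|+k≤0 = contradiction (m+n≤o⇒n≤o (length cs) |cs|+k≤0) λ ()
∃-orthogonal-of-weight≥ (suc n) (suc k) cs |cs|+k≤n with pivotView cs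
... | no-pivot heads≡0 =
  let (y , k≤wy , y⊥rows) = ∃-orthogonal-of-weight≥ n k (map tail cs) |rows|+k≤n
  in  true ◂ y , s≤s k≤wy , All.zipWith (λ {c} → orthogonal {c} y) (heads≡0 , map⁻ y⊥rows)
  where
  |rows|+k≤n : length (map tail cs) + k ≤ n
  |rows|+k≤n rewrite length-map tail cs | +-suc (length cs) k = ≤-pred |cs|+k≤n
  orthogonal : ∀ {c} y → head c ≡ false × tail c · y ≡ false → c · (true ◂ y) ≡ false
  orthogonal {c} y (c₀≡0 , tc·y≡0) rewrite c₀≡0 = tc·y≡0
... | pivot p rest p₀ cs↭ =
  let (y , k<wy , y⊥rows) = ∃-orthogonal-of-weight≥ n (suc k) (map (eliminate p) rest) |rows|+k≤n
      s = tail p · y ◂ y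
  in  s , ≤-trans k<wy (weight-tail s) ,
      All-resp-↭ (↭-sym cs↭) (p-orthogonal ∷ All.map (λ {c} → eliminate-sound p c y) (map⁻ y⊥rows))
  where
  |rows|+k≤n : length (map (eliminate p) rest) + suc k ≤ n
  |rows|+k≤n rewrite length-map (eliminate p) rest | ↭-length cs↭ = ≤-pred |cs|+k≤n
  p-orthogonal : ∀ {y} → p · (tail p · y ◂ y) ≡ false
  p-orthogonal {y} rewrite p₀ = xor-same (tail p · y)

-- Parities of integer sums

bit : Bool → ℤ
bit false = 0ℤ
bit true  = 1ℤ

bit≤1 : ∀ b → bit b ℤ.≤ 1ℤ
bit≤1 false = ℤ.+≤+ z≤n
bit≤1 true  = ℤ.≤-refl

bit-xor : ∀ b c → bit b ℤ.+ bit c ≡ bit (b xor c) ℤ.+ (bit (b ∧ c) ℤ.+ bit (b ∧ c))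
bit-xor false false = refl
bit-xor false true  = refl
bit-xor true  false = refl
bit-xor true  true  = refl

parity-decompositionℕ : ∀ n → ∃[ b ] ∃[ q ] + n ≡ bit b ℤ.+ (q ℤ.+ q)
parity-decompositionℕ zero = false , 0ℤ , refl
parity-decompositionℕ (suc n) with parity-decompositionℕ n
... | false , q , n≡2q   = true  , q , cong (λ z → 1ℤ ℤ.+ z) (trans n≡2q (ℤ.+-identityˡ (q ℤ.+ q)))
... | true  , q , n≡1+2q = false , q ℤ.+ 1ℤ , trans (cong (λ z → 1ℤ ℤ.+ z) n≡1+2q) (carry q)
  where
  carry : ∀ q → 1ℤ ℤ.+ (1ℤ ℤ.+ (q ℤ.+ q)) ≡ 0ℤ ℤ.+ ((q ℤ.+ 1ℤ) ℤ.+ (q ℤ.+ 1ℤ))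
  carry = solve-∀

parity-decomposition : (z : ℤ) → ∃[ b ] ∃[ q ] z ≡ bit b ℤ.+ (q ℤ.+ q)
parity-decomposition (+ n) = parity-decompositionℕ n
parity-decomposition ℤ.-[1+ n ] =
  let (b , q , 1+n≡b+2q) = parity-decompositionℕ (suc n)
  in  b , ℤ.- q ℤ.- bit b , trans (cong ℤ.-_ 1+n≡b+2q) (negate (bit b) q)
  where
  negate : ∀ x q → ℤ.- (x ℤ.+ (q ℤ.+ q)) ≡ x ℤ.+ ((ℤ.- q ℤ.- x) ℤ.+ (ℤ.- q ℤ.- x))
  negate = solve-∀

odd? : ℤ → Bool
odd? z = proj₁ (parity-decomposition z)

odd?-spec : (z : ℤ) → ∃[ q ] z ≡ bit (odd? z) ℤ.+ (q ℤ.+ q)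
odd?-spec z = proj₂ (parity-decomposition z)

-- The parities add in GF(2); the carry b ∧ c joins the even part.
+-parity : ∀ b c q m → (bit b ℤ.+ (q ℤ.+ q)) ℤ.+ (bit c ℤ.+ (m ℤ.+ m)) ≡
           bit (b xor c) ℤ.+ ((bit (b ∧ c) ℤ.+ (q ℤ.+ m)) ℤ.+ (bit (b ∧ c) ℤ.+ (q ℤ.+ m)))
+-parity b c q m = begin
  (bit b ℤ.+ (q ℤ.+ q)) ℤ.+ (bit c ℤ.+ (m ℤ.+ m))      ≡⟨ regroup (bit b) (bit c) q m ⟩
  (bit b ℤ.+ bit c) ℤ.+ ((q ℤ.+ m) ℤ.+ (q ℤ.+ m))      ≡⟨ cong (ℤ._+ ((q ℤ.+ m) ℤ.+ (q ℤ.+ m))) (bit-xor b c) ⟩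
  (bit (b xor c) ℤ.+ (r ℤ.+ r)) ℤ.+ ((q ℤ.+ m) ℤ.+ (q ℤ.+ m)) ≡⟨ regroup′ (bit (b xor c)) r (q ℤ.+ m) ⟩
  bit (b xor c) ℤ.+ ((r ℤ.+ (q ℤ.+ m)) ℤ.+ (r ℤ.+ (q ℤ.+ m))) ∎
  where
  open ≡-Reasoning
  r = bit (b ∧ c)
  regroup : ∀ x y q m → (x ℤ.+ (q ℤ.+ q)) ℤ.+ (y ℤ.+ (m ℤ.+ m)) ≡ (x ℤ.+ y) ℤ.+ ((q ℤ.+ m) ℤ.+ (q ℤ.+ m))
  regroup = solve-∀
  regroup′ : ∀ x r t → (x ℤ.+ (r ℤ.+ r)) ℤ.+ (t ℤ.+ t) ≡ x ℤ.+ ((r ℤ.+ t) ℤ.+ (r ℤ.+ t))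
  regroup′ = solve-∀

sumOn : Vector Bool n → Vector ℤ n → ℤ
sumOn {zero}  s a = 0ℤ
sumOn {suc n} s a = if head s then head a ℤ.+ rest else rest
  where rest = sumOn (tail s) (tail a)

sumOn-parity : (s : Vector Bool n) (a : Vector ℤ n) →
               ∃[ m ] sumOn s a ≡ bit ((odd? ∘ a) · s) ℤ.+ (m ℤ.+ m)
sumOn-parity {zero} s a = 0ℤ , refl
sumOn-parity {suc n} s a with odd?-spec (a zero) | sumOn-parity (tail s) (tail a) | s zero
... | q , a₀≡b+2q | m , Σ≡c+2m | true =
  bit (b ∧ c) ℤ.+ (q ℤ.+ m) ,
  trans (cong₂ ℤ._+_ a₀≡b+2q Σ≡c+2m)
        (trans (+-parity b c q m) (cong (λ x → bit (x xor c) ℤ.+ (r ℤ.+ r)) (sym (∧-identityʳ b))))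
  where b = odd? (a zero); c = (odd? ∘ tail a) · tail s; r = bit (b ∧ c) ℤ.+ (q ℤ.+ m)
... | _ | m , Σ≡c+2m | false =
  m , trans Σ≡c+2m (cong (λ x → bit (x xor c) ℤ.+ (m ℤ.+ m)) (sym (∧-zeroʳ b)))
  where b = odd? (a zero); c = (odd? ∘ tail a) · tail s

sumOn-+ : (s : Vector Bool n) (a b : Vector ℤ n) →
          sumOn s (λ i → a i ℤ.+ b i) ≡ sumOn s a ℤ.+ sumOn s b
sumOn-+ {zero} s a b = refl
sumOn-+ {suc n} s a b with s zero
... | true  = trans (cong (λ x → a zero ℤ.+ b zero ℤ.+ x) (sumOn-+ (tail s) (tail a) (tail b)))
                    (+-interchange (a zero) (b zero) _ _)
... | false = sumOn-+ (tail s) (tail a) (tail b)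

sumOn-zero : (s : Vector Bool n) → sumOn s (λ _ → 0ℤ) ≡ 0ℤ
sumOn-zero {zero} s = refl
sumOn-zero {suc n} s with s zero
... | true  = trans (ℤ.+-identityˡ _) (sumOn-zero (tail s))
... | false = sumOn-zero (tail s)

sumOn-e : (s : Vector Bool n) (i : Fin n) → sumOn s (e i) ≡ bit (s i)
sumOn-e {suc n} s zero with s zero
... | true  = cong (λ x → 1ℤ ℤ.+ x) (sumOn-zero (tail s))
... | false = sumOn-zero (tail s)
sumOn-e {suc n} s (suc i) with s zero
... | true  = trans (ℤ.+-identityˡ _) (sumOn-e (tail s) i)
... | false = sumOn-e (tail s) i

sumOn-1 : (s : Vector Bool n) → sumOn s (λ _ → 1ℤ) ≡ + weight s
sumOn-1 {zero} s = refl
sumOn-1 {suc n} s with s zero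
... | true  = cong (λ x → 1ℤ ℤ.+ x) (sumOn-1 (tail s))
... | false = sumOn-1 (tail s)

-- The half-integral point ½·1_S

toℚᵘ-toℚ : ∀ z → ℚ.toℚᵘ (toℚ z) ℚᵘ.≃ mkℚᵘ z 0
toℚᵘ-toℚ z = ℚ.toℚᵘ-fromℚᵘ (mkℚᵘ z 0)

toℚ-+ : ∀ x y → toℚ (x ℤ.+ y) ≡ toℚ x ℚ.+ toℚ y
toℚ-+ x y = ℚ.toℚᵘ-injective (begin
  ℚ.toℚᵘ (toℚ (x ℤ.+ y))                ≈⟨ toℚᵘ-toℚ (x ℤ.+ y) ⟩
  mkℚᵘ (x ℤ.+ y) 0                       ≈⟨ *≡* (cross-multiplied x y) ⟩
  mkℚᵘ x 0 ℚᵘ.+ mkℚᵘ y 0                 ≈⟨ ℚᵘ.+-cong (toℚᵘ-toℚ x) (toℚᵘ-toℚ y) ⟨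
  ℚ.toℚᵘ (toℚ x) ℚᵘ.+ ℚ.toℚᵘ (toℚ y)     ≈⟨ ℚ.toℚᵘ-homo-+ (toℚ x) (toℚ y) ⟨
  ℚ.toℚᵘ (toℚ x ℚ.+ toℚ y)               ∎)
  where
  open ℚᵘ.≃-Reasoning
  cross-multiplied : ∀ x y → (x ℤ.+ y) ℤ.* 1ℤ ≡ (x ℤ.* 1ℤ ℤ.+ y ℤ.* 1ℤ) ℤ.* 1ℤ
  cross-multiplied = solve-∀

toℚ-mono-≤ : ∀ {x y} → x ℤ.≤ y → toℚ x ℚ.≤ toℚ y
toℚ-mono-≤ {x} {y} x≤y = ℚ.toℚᵘ-cancel-≤
  (ℚᵘ.≤-respˡ-≃ (ℚᵘ.≃-sym (toℚᵘ-toℚ x)) (ℚᵘ.≤-respʳ-≃ (ℚᵘ.≃-sym (toℚᵘ-toℚ y))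
    (*≤* (subst₂ ℤ._≤_ (sym (ℤ.*-identityʳ x)) (sym (ℤ.*-identityʳ y)) x≤y))))

toℚ[m+m]*½ : ∀ m → toℚ (m ℤ.+ m) ℚ.* ½ ≡ toℚ m
toℚ[m+m]*½ m = begin
  toℚ (m ℤ.+ m) ℚ.* ½             ≡⟨ cong (ℚ._* ½) (toℚ-+ m m) ⟩
  (toℚ m ℚ.+ toℚ m) ℚ.* ½         ≡⟨ ℚ.*-distribʳ-+ ½ (toℚ m) (toℚ m) ⟩
  toℚ m ℚ.* ½ ℚ.+ toℚ m ℚ.* ½     ≡⟨ ℚ.*-distribˡ-+ (toℚ m) ½ ½ ⟨
  toℚ m ℚ.* (½ ℚ.+ ½)             ≡⟨ ℚ.*-identityʳ (toℚ m) ⟩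
  toℚ m                           ∎
  where open ≡-Reasoning

toℚ-≤-half : ∀ {m z} → m ℤ.+ m ℤ.≤ z → toℚ m ℚ.≤ toℚ z ℚ.* ½
toℚ-≤-half {m} m+m≤z = subst (ℚ._≤ _) (toℚ[m+m]*½ m) (ℚ.*-monoʳ-≤-nonNeg ½ (toℚ-mono-≤ m+m≤z))

toℚ-half-≤ : ∀ {z m} → z ℤ.≤ m ℤ.+ m → toℚ z ℚ.* ½ ℚ.≤ toℚ m
toℚ-half-≤ {m = m} z≤m+m = subst (_ ℚ.≤_) (toℚ[m+m]*½ m) (ℚ.*-monoʳ-≤-nonNeg ½ (toℚ-mono-≤ z≤m+m))

halfIndicator : Vector Bool n → Vector ℚ n
halfIndicator s i = if s i then ½ else 0ℚ

dot-halfIndicator : (a : Coeffs n) (s : Vector Bool n) → dot a (halfIndicator s) ≡ toℚ (sumOn s a) ℚ.* ½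
dot-halfIndicator {zero} a s = refl
dot-halfIndicator {suc n} a s with s zero | dot-halfIndicator (tail a) (tail s)
... | true | IH = begin
  toℚ (a zero) ℚ.* ½ ℚ.+ dot (tail a) (halfIndicator (tail s)) ≡⟨ cong (toℚ (a zero) ℚ.* ½ ℚ.+_) IH ⟩
  toℚ (a zero) ℚ.* ½ ℚ.+ toℚ S ℚ.* ½                         ≡⟨ ℚ.*-distribʳ-+ ½ (toℚ (a zero)) (toℚ S) ⟨
  (toℚ (a zero) ℚ.+ toℚ S) ℚ.* ½                               ≡⟨ cong (ℚ._* ½) (toℚ-+ (a zero) S) ⟨
  toℚ (a zero ℤ.+ S) ℚ.* ½                                     ∎
  where open ≡-Reasoning; S = sumOn (tail s) (tail a)
... | false | IH = begin
  toℚ (a zero) ℚ.* 0ℚ ℚ.+ dot (tail a) (halfIndicator (tail s)) ≡⟨ cong₂ ℚ._+_ (ℚ.*-zeroʳ (toℚ (a zero))) IH ⟩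
  0ℚ ℚ.+ toℚ (sumOn (tail s) (tail a)) ℚ.* ½                    ≡⟨ ℚ.+-identityˡ _ ⟩
  toℚ (sumOn (tail s) (tail a)) ℚ.* ½                           ∎
  where open ≡-Reasoning

dot-halfIndicator-integral : (a : Coeffs n) (s : Vector Bool n) → (odd? ∘ a) · s ≡ false →
                             ∃[ m ] dot a (halfIndicator s) ≡ toℚ m
dot-halfIndicator-integral a s orth with sumOn-parity s a
... | m , Σ≡c+2m = m , (begin
  dot a (halfIndicator s)                 ≡⟨ dot-halfIndicator a s ⟩
  toℚ (sumOn s a) ℚ.* ½                   ≡⟨ cong (λ z → toℚ z ℚ.* ½) Σ≡2m ⟩
  toℚ (0ℤ ℤ.+ (m ℤ.+ m)) ℚ.* ½            ≡⟨ cong (λ z → toℚ z ℚ.* ½) (ℤ.+-identityˡ (m ℤ.+ m)) ⟩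
  toℚ (m ℤ.+ m) ℚ.* ½                     ≡⟨ toℚ[m+m]*½ m ⟩
  toℚ m                                   ∎)
  where
  open ≡-Reasoning
  Σ≡2m : sumOn s a ≡ 0ℤ ℤ.+ (m ℤ.+ m)
  Σ≡2m = trans Σ≡c+2m (cong (λ c → bit c ℤ.+ (m ℤ.+ m)) orth)

OutsideSlab : Vector ℚ n → Coeffs n × ℤ → Set
OutsideSlab x (a , b) = Sat x (a ≥ᵢ b) ⊎ Sat x (a ≤ᵢ (b ℤ.- 1ℤ))

integral⇒outsideSlab : ∀ {x : Vector ℚ n} a b → ∃[ m ] dot a x ≡ toℚ m → OutsideSlab x (a , b)
integral⇒outsideSlab a b (m , a·x≡m) with b ℤ.≤? m
... | yes b≤m = inj₁ (subst (toℚ b ℚ.≤_) (sym a·x≡m) (toℚ-mono-≤ b≤m))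
... | no  b≰m = inj₂ (subst (ℚ._≤ toℚ (b ℤ.- 1ℤ)) (sym a·x≡m) (toℚ-mono-≤ m≤b-1))
  where
  m≤b-1 : m ℤ.≤ b ℤ.- 1ℤ
  m≤b-1 = subst (m ℤ.≤_) (ℤ.+-comm ℤ.-1ℤ b) (ℤ.i<j⇒i≤pred[j] (ℤ.≰⇒> b≰m))

halfIndicator-satisfies-SPHP : (s : Vector Bool n) → 4 ≤ weight s → ∀ I → SPHP n I → Sat (halfIndicator s) I
halfIndicator-satisfies-SPHP s 4≤ws _ sumAxiom =
  subst (toℚ (+ 2) ℚ.≤_) (sym (dot-halfIndicator _ s))
    (toℚ-≤-half {m = + 2} (subst (+ 4 ℤ.≤_) (sym (sumOn-1 s)) (ℤ.+≤+ 4≤ws)))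
halfIndicator-satisfies-SPHP s _ _ (pairAxiom i j _) =
  subst (ℚ._≤ toℚ 1ℤ) (sym (dot-halfIndicator _ s))
    (toℚ-half-≤ {m = 1ℤ} (subst (ℤ._≤ 1ℤ ℤ.+ 1ℤ) (sym Σ≡si+sj)
      (ℤ.+-mono-≤ (bit≤1 (s i)) (bit≤1 (s j)))))
  where
  Σ≡si+sj : sumOn s (λ k → e i k ℤ.+ e j k) ≡ bit (s i) ℤ.+ bit (s j)
  Σ≡si+sj = trans (sumOn-+ s (e i) (e j)) (cong₂ ℤ._+_ (sumOn-e s i) (sumOn-e s j))

queries : SPTree n → List (Coeffs n × ℤ)
queries leaf            = []
queries (query a b l r) = (a , b) ∷ queries l ++ queries r

length-queries : (T : SPTree n) → length (queries T) ≡ spLength T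
length-queries leaf            = refl
length-queries (query a b l r) =
  cong suc (trans (length-++ (queries l)) (cong₂ _+_ (length-queries l) (length-queries r)))

-- x decides every query it meets, so it runs down to a leaf whose LP it satisfies.
outsideSlabs⇒¬refutation : (F : Formula n) (x : Vector ℚ n) → (∀ I → F I → Sat x I) →
  ∀ {P} T → All (Sat x) P → All (OutsideSlab x) (queries T) → ¬ IsRefutationFrom F P T
outsideSlabs⇒¬refutation F x x⊨F leaf x⊨P _ refutes = refutes (x , x⊨F , x⊨P)
outsideSlabs⇒¬refutation F x x⊨F (query a b l r) x⊨P (inj₁ a·x≥b ∷ outside) (refutesˡ , _) =
  outsideSlabs⇒¬refutation F x x⊨F l (a·x≥b ∷ x⊨P) (++⁻ˡ (queries l) outside) refutesˡ
outsideSlabs⇒¬refutation F x x⊨F (query a b l r) x⊨P (inj₂ a·x<b ∷ outside) (_ , refutesʳ) =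
  outsideSlabs⇒¬refutation F x x⊨F r (a·x<b ∷ x⊨P) (++⁻ʳ (queries l) outside) refutesʳ

queryParities : SPTree n → List (Vector Bool n)
queryParities T = map (λ q → odd? ∘ proj₁ q) (queries T)

sphp-refutation-length : (T : SPTree n) → IsSPRefutation (SPHP n) T → n ≤ spLength T + 3
sphp-refutation-length {n} T refutes with n ℕ.≤? spLength T + 3
... | yes n≤L+3 = n≤L+3
... | no  n≰L+3 with ∃-orthogonal-of-weight≥ n 4 (queryParities T) |rows|+4≤n
  where
  open ℕ.≤-Reasoning
  |rows|+4≤n : length (queryParities T) + 4 ≤ n
  |rows|+4≤n = begin
    length (queryParities T) + 4 ≡⟨ cong (_+ 4) (trans (length-map _ (queries T)) (length-queries T)) ⟩
    spLength T + 4               ≡⟨ +-suc (spLength T) 3 ⟩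
    suc (spLength T + 3)         ≤⟨ ℕ.≰⇒> n≰L+3 ⟩
    n                            ∎
...   | s , 4≤ws , orthogonal =
  contradiction refutes (outsideSlabs⇒¬refutation (SPHP n) (halfIndicator s)
    (halfIndicator-satisfies-SPHP s 4≤ws) T [] (All.map (λ {q} → outside q) (map⁻ orthogonal)))
  where
  outside : ∀ q → (odd? ∘ proj₁ q) · s ≡ false → OutsideSlab (halfIndicator s) q
  outside (a , b) orth = integral⇒outsideSlab a b (dot-halfIndicator-integral a s orth)

-- Length, depth and the asymptotic bounds

length<2^depth : (T : SPTree n) → spLength T < 2 ^ spDepth T
length<2^depth leaf            = s≤s z≤n
length<2^depth (query a b l r) = begin
  suc (suc (Lˡ + Lʳ))   ≡⟨ cong suc (+-suc Lˡ Lʳ) ⟨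
  suc Lˡ + suc Lʳ       ≤⟨ +-mono-≤ (length<2^depth l) (length<2^depth r) ⟩
  2 ^ dˡ + 2 ^ dʳ       ≤⟨ +-mono-≤ (^-monoʳ-≤ 2 (m≤m⊔n dˡ dʳ)) (^-monoʳ-≤ 2 (m≤n⊔m dˡ dʳ)) ⟩
  2 ^ d + 2 ^ d         ≡⟨ cong (λ x → 2 ^ d + x) (+-identityʳ (2 ^ d)) ⟨
  2 ^ suc d             ∎
  where
  open ℕ.≤-Reasoning
  Lˡ = spLength l; Lʳ = spLength r; dˡ = spDepth l; dʳ = spDepth r; d = dˡ ⊔ dʳ

n≤m+3⇒n≤4m : ∀ {n m} → 4 ≤ n → n ≤ m + 3 → n ≤ 4 * m
n≤m+3⇒n≤4m {m = zero}    4≤n n≤3   = contradiction (≤-trans 4≤n n≤3) (ℕ.<-irrefl refl)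
n≤m+3⇒n≤4m {m = m@(suc _)} _ n≤m+3 = ≤-trans n≤m+3 (+-monoʳ-≤ m (m≤m*n 3 m))

m≤m^4 : ∀ m → m ≤ m ^ 4
m≤m^4 zero      = z≤n
m≤m^4 m@(suc _) = m≤m*n m (m ^ 3) {{m^n≢0 m 3}}

⌊log₂n⌋≤3d : ∀ {n m d} → 4 ≤ n → n ≤ 4 * m → m < 2 ^ d → ⌊log₂ n ⌋ ≤ 3 * d
⌊log₂n⌋≤3d {d = zero} 4≤n n≤4m (s≤s z≤n) = contradiction (≤-trans 4≤n n≤4m) λ ()
⌊log₂n⌋≤3d {n} {m} {d@(suc _)} _ n≤4m m<2^d = begin
  ⌊log₂ n ⌋             ≤⟨ ⌊log₂⌋-mono-≤ n≤2^[2+d] ⟩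
  ⌊log₂ (2 ^ (2 + d)) ⌋ ≡⟨ ⌊log₂[2^n]⌋≡n (2 + d) ⟩
  2 + d                 ≡⟨ +-comm 2 d ⟩
  d + 2                 ≤⟨ +-monoʳ-≤ d (m≤m*n 2 d) ⟩
  3 * d                 ∎
  where
  open ℕ.≤-Reasoning
  n≤2^[2+d] : n ≤ 2 ^ (2 + d)
  n≤2^[2+d] = ≤-trans n≤4m
    (≤-trans (*-monoʳ-≤ 4 (ℕ.<⇒≤ m<2^d)) (ℕ.≤-reflexive (ℕ.*-assoc 2 2 (2 ^ d))))

mainTheorem7 : (Σ ℕ λ c → Σ ℕ λ n₀ → (n : ℕ) → n₀ ≤ n → (T : SPTree n) →
    IsSPRefutation (SPHP n) T → n ≤ c * (spLength T ^ 4))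
    ×
    (Σ ℕ λ c → Σ ℕ λ n₀ → (n : ℕ) → n₀ ≤ n → (T : SPTree n) →
    IsSPRefutation (SPHP n) T → ⌊log₂ n ⌋ ≤ c * spDepth T)
mainTheorem7 =
  (4 , 4 , λ n 4≤n T refutes → ≤-trans (n≤4L 4≤n T refutes) (*-monoʳ-≤ 4 (m≤m^4 (spLength T)))) ,
  (3 , 4 , λ n 4≤n T refutes → ⌊log₂n⌋≤3d {d = spDepth T} 4≤n (n≤4L 4≤n T refutes) (length<2^depth T))
  where
  n≤4L : ∀ {n} → 4 ≤ n → (T : SPTree n) → IsSPRefutation (SPHP n) T → n ≤ 4 * spLength T
  n≤4L 4≤n T refutes = n≤m+3⇒n≤4m 4≤n (sphp-refutation-length T refutes)
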